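{- Let $G=(V,E)$ be a graph, $X,Y\subseteq V$, and let $(T,\beta)$ be a tree-decomposition of $G$ of width $\mathrm{tw}$. Let $S\subseteq X$ be a shattered set. Then $|S|\le\log_2\mathrm{tw}+2$, or there exists a node $t\in V(T)$ with $S\subseteq\beta(t)$.
   Context: $S\subseteq X$ is shattered if for every $S'\subseteq S$ there is $y\in Y$ with $N(y)\cap S=S'$, where $N(y)$ is the open neighborhood of $y$ in $G$. A tree-decomposition of $G$ is a pair $(T,\beta)$ with $T$ a tree and $\beta:V(T)\to 2^{V(G)}$ such that every edge of $G$ has both endpoints in some bag $\beta(t)$, and for each $v\in V(G)$ the set of nodes $t$ with $v\in\beta(t)$ induces a non-empty subtree of $T$; its width is $\max_{t}|\beta(t)|-1$. -}

module Defs where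

open import Data.Nat using (ℕ; suc; _≤_; _+_)
open import Data.Fin using (Fin)
open import Data.Fin.Subset using (Subset; _∈_; _∉_; _⊆_; ∣_∣)
open import Data.List using (List; []; _∷_; length)
open import Data.List.Relation.Unary.Unique.Propositional using (Unique)
open import Data.List.Relation.Unary.Linked using (Linked)
open import Data.List using (last)
open import Data.Maybe using (just)
open import Data.Product using (Σ; ∃; _×_)
open import Relation.Binary.PropositionalEquality using (_≡_)
open import Relation.Nullary using (¬_)
open import Function.Bundles using (_⇔_)
import Data.Unit
import Data.Empty

record Graph (n : ℕ) : Set₁ where
  field
    Adj     : Fin n → Fin n → Set
    sym     : ∀ {u v} → Adj u v → Adj v u
    irrefl  : ∀ {u} → ¬ Adj u u
open Graph public

data Walk {n : ℕ} (G : Graph n) (P : Fin n → Set) : Fin n → Fin n → Set where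
  here : ∀ {u} → P u → Walk G P u u
  step : ∀ {u v w} → P u → Adj G u v → Walk G P v w → Walk G P u w

InducedConnected : {n : ℕ} → Graph n → (Fin n → Set) → Set
InducedConnected G P = ∀ u v → P u → P v → Walk G P u v

IsCycle : {n : ℕ} → Graph n → List (Fin n) → Set
IsCycle G [] = Data.Empty.⊥
IsCycle G (v₀ ∷ vs) =
  (3 ≤ length (v₀ ∷ vs)) × Unique (v₀ ∷ vs) × Linked (Adj G) (v₀ ∷ vs)
  × Σ (Fin _) (λ w → (last (v₀ ∷ vs) ≡ just w) × Adj G w v₀)

Acyclic : {n : ℕ} → Graph n → Set
Acyclic G = ∀ cs → ¬ IsCycle G cs

record Tree : Set₁ where
  field
    size      : ℕ
    nonempty  : 1 ≤ size
    graph     : Graph size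
    connected : InducedConnected graph (λ _ → Data.Unit.⊤)
    acyclic   : Acyclic graph
open Tree public

record TreeDecomposition {n : ℕ} (G : Graph n) : Set₁ where
  field
    T         : Tree
    β         : Fin (size T) → Subset n
    edgeCover : ∀ u v → Adj G u v → ∃ λ t → (u ∈ β t) × (v ∈ β t)
    vertexIn  : ∀ v → ∃ λ t → v ∈ β t
    vertexCon : ∀ v → InducedConnected (graph T) (λ t → v ∈ β t)
open TreeDecomposition public

HasWidth : {n : ℕ} {G : Graph n} → TreeDecomposition G → ℕ → Set
HasWidth D w = (∀ t → ∣ β D t ∣ ≤ suc w) × (∃ λ t → ∣ β D t ∣ ≡ suc w)

Shattered : {n : ℕ} → Graph n → (X Y S : Subset n) → Set
Shattered G X Y S =
  S ⊆ X × (∀ S' → S' ⊆ S → ∃ λ y → y ∈ Y × (∀ v → ((v ∈ S × Adj G y v) ⇔ v ∈ S')))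

{-# OPTIONS --safe #-}

-- If no bag contains S, try to move a bag t containing the first few vertices of S so that it also
-- contains the next one, c: on the way from t to the subtree of c we cross an edge pq with c ∈ β q,
-- and if β q misses a vertex a ∈ S of β t, then the subtrees of a and c lie on opposite sides of pq.
-- Every common neighbour of a and c therefore has bags on both sides and lies in β q. Shattering
-- provides 2 ^ (|S| - 2) distinct such neighbours, and together with c they fit into |β q| ≤ tw + 1,
-- whence 2 ^ |S| ≤ 4 tw.

module Submission where

open import Defs
open import Data.Nat using (ℕ; suc; _+_; _*_; _^_; _≤_; z≤n; s≤s)
open import Data.Nat.Properties using (≤-trans; ≤-reflexive; +-suc; +-monoʳ-≤; n≤1+n; *-comm; *-monoʳ-≤; *-monoˡ-≤; ^-monoʳ-≤; module ≤-Reasoning)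
open import Data.Nat.Solver using (module +-*-Solver)
open import Data.Fin using (Fin; fromℕ<)
open import Data.Fin.Properties using (_≟_)
open import Data.Fin.Subset using (Subset; inside; outside; _∈_; _∉_; _⊆_; ∣_∣; _∪_; _∩_; ⁅_⁆)
open import Data.Fin.Subset.Properties using (⊆-antisym; drop-∷-⊆; out⊆; s⊆s; p∩q⊆p; p∩q⊆q; x∈p∩q⁺; x∈p∪q⁺; x∈p∪q⁻; x∈⁅x⁆; x∈⁅y⁆⇒x≡y; ∣⁅x⁆∣≡1; x∈p⇒∣p-x∣<∣p∣; x∈p∧x≢y⇒x∈p-y) renaming (_∈?_ to _∈ₛ?_)
open import Data.Vec using ([]; _∷_; here)
open import Data.Vec.Properties using (∷-injectiveˡ; ∷-injectiveʳ)
open import Data.List using (List; []; _∷_; [_]; length; map; _++_; last; filter; allFin)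
open import Data.List.Properties using (length-map; length-++)
open import Data.List.Relation.Unary.All as All using (All; []; _∷_)
open import Data.List.Relation.Unary.All.Properties using (¬All⇒Any¬; ¬Any⇒All¬; all-filter) renaming (map⁺ to All-map⁺; ++⁺ to All-++⁺)
open import Data.List.Relation.Unary.Any as Any using ()
open import Data.List.Relation.Unary.AllPairs using ([]; _∷_)
open import Data.List.Relation.Unary.Linked as Linked using (Linked; [-]; _∷_)
open import Data.List.Relation.Unary.Unique.Propositional using (Unique)
import Data.List.Relation.Unary.Unique.Propositional.Properties as Unique
open import Data.List.Membership.Propositional using () renaming (_∈_ to _∈ₗ_)
open import Data.List.Membership.Propositional.Properties using (∈-map⁻; ∈-allFin; ∈-filter⁺)
open import Data.Product using (∃; _×_; _,_; proj₁; proj₂)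
import Data.Product as Product
open import Data.Maybe using (just)
open import Data.Maybe.Properties using (just-injective)
open import Data.Sum using (_⊎_; inj₁; inj₂)
open import Data.Empty using (⊥-elim)
open import Function using (_∘_)
open import Function.Bundles using (_⇔_; Equivalence)
open import Relation.Nullary using (¬_; Dec; yes; no; contradiction)
open import Relation.Nullary.Decidable using (_×-dec_; _⊎-dec_; decidable-stable)
open import Relation.Unary using (Decidable)
open import Relation.Binary.Definitions using (DecidableEquality)
open import Relation.Binary.Construct.Closure.ReflexiveTransitive using (Star; ε; _◅_)
open import Relation.Binary.PropositionalEquality using (_≡_; _≢_; refl; trans; cong; cong₂; subst; module ≡-Reasoning) renaming (sym to ≡-sym)

∣p∪q∣≤∣p∣+∣q∣ : ∀ {k} (p q : Subset k) → ∣ p ∪ q ∣ ≤ ∣ p ∣ + ∣ q ∣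
∣p∪q∣≤∣p∣+∣q∣ []            []            = z≤n
∣p∪q∣≤∣p∣+∣q∣ (inside ∷ p)  (inside ∷ q)  =
  s≤s (≤-trans (∣p∪q∣≤∣p∣+∣q∣ p q) (+-monoʳ-≤ ∣ p ∣ (n≤1+n _)))
∣p∪q∣≤∣p∣+∣q∣ (inside ∷ p)  (outside ∷ q) = s≤s (∣p∪q∣≤∣p∣+∣q∣ p q)
∣p∪q∣≤∣p∣+∣q∣ (outside ∷ p) (inside ∷ q)  =
  ≤-trans (s≤s (∣p∪q∣≤∣p∣+∣q∣ p q)) (≤-reflexive (≡-sym (+-suc ∣ p ∣ ∣ q ∣)))
∣p∪q∣≤∣p∣+∣q∣ (outside ∷ p) (outside ∷ q) = ∣p∪q∣≤∣p∣+∣q∣ p q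

∣⁅x⁆∪⁅y⁆∣≤2 : ∀ {k} (x y : Fin k) → ∣ ⁅ x ⁆ ∪ ⁅ y ⁆ ∣ ≤ 2
∣⁅x⁆∪⁅y⁆∣≤2 x y =
  ≤-trans (∣p∪q∣≤∣p∣+∣q∣ ⁅ x ⁆ ⁅ y ⁆) (≤-reflexive (cong₂ _+_ (∣⁅x⁆∣≡1 x) (∣⁅x⁆∣≡1 y)))

⁅x⁆∪⁅y⁆⊆p : ∀ {k} {x y : Fin k} {p : Subset k} → x ∈ p → y ∈ p → ⁅ x ⁆ ∪ ⁅ y ⁆ ⊆ p
⁅x⁆∪⁅y⁆⊆p {x = x} {y} x∈p y∈p v∈ with x∈p∪q⁻ ⁅ x ⁆ ⁅ y ⁆ v∈
... | inj₁ v∈⁅x⁆ = subst (_∈ _) (≡-sym (x∈⁅y⁆⇒x≡y x v∈⁅x⁆)) x∈p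
... | inj₂ v∈⁅y⁆ = subst (_∈ _) (≡-sym (x∈⁅y⁆⇒x≡y y v∈⁅y⁆)) y∈p

unique⊆⇒length≤∣p∣ : ∀ {k} {xs : List (Fin k)} {p : Subset k}
                   → Unique xs → All (_∈ p) xs → length xs ≤ ∣ p ∣
unique⊆⇒length≤∣p∣ []              []           = z≤n
unique⊆⇒length≤∣p∣ (x∉xs ∷ unique) (x∈p ∷ xs⊆p) =
  ≤-trans (s≤s (unique⊆⇒length≤∣p∣ unique xs⊆p-x)) (x∈p⇒∣p-x∣<∣p∣ x∈p)
  where
  xs⊆p-x = All.zipWith (λ (y∈p , x≢y) → x∈p∧x≢y⇒x∈p-y y∈p (x≢y ∘ ≡-sym)) (xs⊆p , x∉xs)

map⁺-injectiveOn : ∀ {A B : Set} {P : A → Set} (f : A → B)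
                 → (∀ {x y} → P x → P y → f x ≡ f y → x ≡ y)
                 → ∀ {xs} → All P xs → Unique xs → Unique (map f xs)
map⁺-injectiveOn f inj []         []              = []
map⁺-injectiveOn f inj (px ∷ pxs) (x∉xs ∷ unique) =
  All-map⁺ (All.zipWith (λ (py , x≢y) → x≢y ∘ inj px py) (pxs , x∉xs))
  ∷ map⁺-injectiveOn f inj pxs unique

interval : ∀ {k} → Subset k → Subset k → List (Subset k)
interval []            []            = [ [] ]
interval (outside ∷ L) (outside ∷ S) = map (outside ∷_) (interval L S)
interval (inside ∷ L)  (inside ∷ S)  = map (inside ∷_) (interval L S)
interval (outside ∷ L) (inside ∷ S)  =
  map (inside ∷_) (interval L S) ++ map (outside ∷_) (interval L S)
interval (inside ∷ L)  (outside ∷ S) = []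

interval-bounds : ∀ {k} (L S : Subset k) → All (λ U → L ⊆ U × U ⊆ S) (interval L S)
interval-bounds []            []            = ((λ ()) , (λ ())) ∷ []
interval-bounds (outside ∷ L) (outside ∷ S) =
  All-map⁺ (All.map (Product.map out⊆ out⊆) (interval-bounds L S))
interval-bounds (inside ∷ L)  (inside ∷ S)  =
  All-map⁺ (All.map (Product.map s⊆s s⊆s) (interval-bounds L S))
interval-bounds (outside ∷ L) (inside ∷ S)  =
  All-++⁺ (All-map⁺ (All.map (Product.map out⊆ s⊆s) (interval-bounds L S)))
          (All-map⁺ (All.map (Product.map out⊆ out⊆) (interval-bounds L S)))
interval-bounds (inside ∷ L)  (outside ∷ S) = []

interval-unique : ∀ {k} (L S : Subset k) → Unique (interval L S)
interval-unique []            []            = [] ∷ []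
interval-unique (outside ∷ L) (outside ∷ S) = Unique.map⁺ ∷-injectiveʳ (interval-unique L S)
interval-unique (inside ∷ L)  (inside ∷ S)  = Unique.map⁺ ∷-injectiveʳ (interval-unique L S)
interval-unique (outside ∷ L) (inside ∷ S)  =
  Unique.++⁺ (Unique.map⁺ ∷-injectiveʳ (interval-unique L S))
             (Unique.map⁺ ∷-injectiveʳ (interval-unique L S)) disjoint
  where
  disjoint : ∀ {U} → ¬ (U ∈ₗ map (inside ∷_) (interval L S) × U ∈ₗ map (outside ∷_) (interval L S))
  disjoint (U∈ , U∈′) with ∈-map⁻ (inside ∷_) U∈ | ∈-map⁻ (outside ∷_) U∈′
  ... | _ , _ , refl | _ , _ , eq with ∷-injectiveˡ eq
  ... | ()
interval-unique (inside ∷ L)  (outside ∷ S) = []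

interval-length : ∀ {k} {L S : Subset k} → L ⊆ S → length (interval L S) * 2 ^ ∣ L ∣ ≡ 2 ^ ∣ S ∣
interval-length {L = []}          {[]}          _   = refl
interval-length {L = outside ∷ L} {outside ∷ S} L⊆S = begin
  length (map (outside ∷_) Us) * 2 ^ ∣ L ∣ ≡⟨ cong (_* 2 ^ ∣ L ∣) (length-map _ Us) ⟩
  length Us * 2 ^ ∣ L ∣                    ≡⟨ interval-length (drop-∷-⊆ L⊆S) ⟩
  2 ^ ∣ S ∣                                ∎
  where
  open ≡-Reasoning
  Us = interval L S
interval-length {L = inside ∷ L}  {inside ∷ S}  L⊆S = begin
  length (map (inside ∷_) Us) * (2 * 2 ^ ∣ L ∣)
    ≡⟨ cong (_* (2 * 2 ^ ∣ L ∣)) (length-map _ Us) ⟩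
  length Us * (2 * 2 ^ ∣ L ∣)
    ≡⟨ solve 2 (λ m x → m :* (con 2 :* x) := con 2 :* (m :* x)) refl (length Us) (2 ^ ∣ L ∣) ⟩
  2 * (length Us * 2 ^ ∣ L ∣)
    ≡⟨ cong (2 *_) (interval-length (drop-∷-⊆ L⊆S)) ⟩
  2 * 2 ^ ∣ S ∣
    ∎
  where
  open ≡-Reasoning
  open +-*-Solver
  Us = interval L S
interval-length {L = outside ∷ L} {inside ∷ S}  L⊆S = begin
  length (map (inside ∷_) Us ++ map (outside ∷_) Us) * 2 ^ ∣ L ∣
    ≡⟨ cong (_* 2 ^ ∣ L ∣) lengths ⟩
  (length Us + length Us) * 2 ^ ∣ L ∣
    ≡⟨ solve 2 (λ m x → (m :+ m) :* x := con 2 :* (m :* x)) refl (length Us) (2 ^ ∣ L ∣) ⟩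
  2 * (length Us * 2 ^ ∣ L ∣)
    ≡⟨ cong (2 *_) (interval-length (drop-∷-⊆ L⊆S)) ⟩
  2 * 2 ^ ∣ S ∣
    ∎
  where
  open ≡-Reasoning
  open +-*-Solver
  Us = interval L S
  lengths : length (map (inside ∷_) Us ++ map (outside ∷_) Us) ≡ length Us + length Us
  lengths = trans (length-++ (map (inside ∷_) Us)) (cong₂ _+_ (length-map _ Us) (length-map _ Us))
interval-length {L = inside ∷ L}  {outside ∷ S} L⊆S = contradiction (L⊆S here) λ ()

record Path {A : Set} (R : A → A → Set) (x z : A) : Set where
  field
    rest   : List A
    linked : Linked R (x ∷ rest)
    unique : Unique (x ∷ rest)
    ends   : last (x ∷ rest) ≡ just z

module _ {A : Set} (_≟_ : DecidableEquality A) {R : A → A → Set} where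

  open import Data.List.Membership.DecPropositional _≟_ using () renaming (_∈?_ to _∈ₗ?_)

  private
    suffix-path : ∀ {x z} (xs : List A) → x ∈ₗ xs → Linked R xs → Unique xs → last xs ≡ just z
                → Path R x z
    suffix-path (x ∷ xs)     (Any.here refl) linked       unique       ends =
      record { rest = xs ; linked = linked ; unique = unique ; ends = ends }
    suffix-path (_ ∷ y ∷ ys) (Any.there x∈)  (_ ∷ linked) (_ ∷ unique) ends =
      suffix-path (y ∷ ys) x∈ linked unique ends

  star⇒path : ∀ {x z} → Star R x z → Path R x z
  star⇒path ε = record { rest = [] ; linked = [-] ; unique = [] ∷ [] ; ends = refl }
  star⇒path {x} (_◅_ {j = y} r rs) with star⇒path rs
  ... | record { rest = ys ; linked = linked ; unique = unique ; ends = ends } with x ∈ₗ? (y ∷ ys)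
  ...   | yes x∈ = suffix-path (y ∷ ys) x∈ linked unique ends
  ...   | no x∉ =
    record { rest = y ∷ ys ; linked = r ∷ linked ; unique = ¬Any⇒All¬ _ x∉ ∷ unique ; ends = ends }

module _ {m : ℕ} (H : Graph m) where

  Traverses : Fin m → Fin m → Fin m → Fin m → Set
  Traverses p q x y = (x ≡ p × y ≡ q) ⊎ (x ≡ q × y ≡ p)

  traverses? : ∀ p q x y → Dec (Traverses p q x y)
  traverses? p q x y = ((x ≟ p) ×-dec (y ≟ q)) ⊎-dec ((x ≟ q) ×-dec (y ≟ p))

  traverses-sym : ∀ {p q x y} → Traverses p q x y → Traverses p q y x
  traverses-sym (inj₁ (x≡p , y≡q)) = inj₂ (y≡q , x≡p)
  traverses-sym (inj₂ (x≡q , y≡p)) = inj₁ (y≡p , x≡q)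

  StepAvoiding : Fin m → Fin m → Fin m → Fin m → Set
  StepAvoiding p q x y = Adj H x y × ¬ Traverses p q x y

  -- Side p q is the component of p in H with the edge pq deleted.
  Side : Fin m → Fin m → Fin m → Set
  Side p q t = Star (StepAvoiding p q) t p

  acyclic⇒q∉Side : Acyclic H → ∀ {p q} → Adj H p q → ¬ Side p q q
  acyclic⇒q∉Side acyclic {p} {q} pq q∈Side = no-path (star⇒path _≟_ q∈Side)
    where
    no-path : ¬ Path (StepAvoiding p q) q p
    no-path record { rest = [] ; ends = ends } = irrefl H (subst (Adj H p) (just-injective ends) pq)
    no-path record { rest = _ ∷ [] ; linked = (_ , ¬pq) ∷ [-] ; ends = ends } =
      ¬pq (inj₂ (refl , just-injective ends))
    no-path record { rest = v ∷ w ∷ ws ; linked = linked ; unique = unique ; ends = ends } =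
      acyclic (q ∷ v ∷ w ∷ ws) (s≤s (s≤s (s≤s z≤n)) , unique , Linked.map proj₁ linked , p , ends , pq)

  walk-start : ∀ {P u v} → Walk H P u v → P u
  walk-start (here Pu)     = Pu
  walk-start (step Pu _ _) = Pu

  walk-leaving-Side : ∀ {P p q x z} → Walk H P x z → Side p q x → ¬ Side p q z → P p × P q
  walk-leaving-Side (here _) x∈Side z∉Side = ⊥-elim (z∉Side x∈Side)
  walk-leaving-Side {p = p} {q} (step {x} {y} Px xy walk) x∈Side z∉Side with traverses? p q x y
  ... | yes (inj₁ (refl , refl)) = Px , walk-start walk
  ... | yes (inj₂ (refl , refl)) = walk-start walk , Px
  ... | no ¬pq = walk-leaving-Side walk ((Graph.sym H xy , ¬pq ∘ traverses-sym) ◅ x∈Side) z∉Side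

  record BoundaryEdge (Q : Fin m → Set) (t : Fin m) : Set where
    field
      p q    : Fin m
      edge   : Adj H p q
      ¬Q-p   : ¬ Q p
      Q-q    : Q q
      t∈Side : Side p q t

  boundary-edge : ∀ {Q : Fin m → Set} {P t r} → Decidable Q → Walk H P t r → ¬ Q t → Q r → BoundaryEdge Q t
  boundary-edge Q? (here _) ¬Qt Qr = ⊥-elim (¬Qt Qr)
  boundary-edge {Q} Q? (step {t} {t′} _ tt′ walk) ¬Qt Qr with Q? t′
  ... | yes Qt′ = record { p = t ; q = t′ ; edge = tt′ ; ¬Q-p = ¬Qt ; Q-q = Qt′ ; t∈Side = ε }
  ... | no ¬Qt′ = record { BoundaryEdge next ; t∈Side = (tt′ , avoids) ◅ t∈Side }
    where
    next = boundary-edge Q? walk ¬Qt′ Qr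
    open BoundaryEdge next
    avoids : ¬ Traverses p q t t′
    avoids (inj₁ (_ , t′≡q)) = ¬Qt′ (subst Q (≡-sym t′≡q) Q-q)
    avoids (inj₂ (t≡q , _))  = ¬Qt (subst Q (≡-sym t≡q) Q-q)

module _ {n : ℕ} {G : Graph n} (D : TreeDecomposition G) where

  private
    Node : Set
    Node = Fin (size (T D))

    Tree-graph : Graph (size (T D))
    Tree-graph = graph (T D)

  bags-crossing-edge : ∀ {v p q r r′} → Side Tree-graph p q r → ¬ Side Tree-graph p q r′
                     → v ∈ β D r → v ∈ β D r′ → v ∈ β D p × v ∈ β D q
  bags-crossing-edge {v} {r = r} {r′} r∈Side r′∉Side v∈r v∈r′ =
    walk-leaving-Side Tree-graph (vertexCon D v r r′ v∈r v∈r′) r∈Side r′∉Side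

  -- In a separation the subtrees of a and c lie on opposite sides of pq, with c ∈ β q.
  record Separation (S : Subset n) : Set where
    field
      a c   : Fin n
      a∈S   : a ∈ S
      c∈S   : c ∈ S
      t     : Node
      a∈t   : a ∈ β D t
      entry : BoundaryEdge Tree-graph (λ r → c ∈ β D r) t
    open BoundaryEdge entry public
    field
      a∉q   : a ∉ β D q

  module _ {S : Subset n} (sep : Separation S) where

    open Separation sep

    c-bags-off-Side : ∀ {r} → c ∈ β D r → ¬ Side Tree-graph p q r
    c-bags-off-Side c∈r r∈Side =
      ¬Q-p (proj₁ (bags-crossing-edge r∈Side (acyclic⇒q∉Side Tree-graph (acyclic (T D)) edge) c∈r Q-q))

    -- If y ∉ β q, the subtree of y, which meets that of c, lies off p's side;
    -- it also meets the subtree of a, which therefore crosses pq.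
    common-neighbour∈q : ∀ {y} → Adj G y a → Adj G y c → y ∈ β D q
    common-neighbour∈q {y} ya yc with edgeCover D y a ya | edgeCover D y c yc
    ... | r₁ , y∈r₁ , a∈r₁ | r₂ , y∈r₂ , c∈r₂ = decidable-stable (y ∈ₛ? β D q) λ y∉q →
      let r₁∉Side : ¬ Side Tree-graph p q r₁
          r₁∉Side r₁∈Side = y∉q (proj₂ (bags-crossing-edge r₁∈Side (c-bags-off-Side c∈r₂) y∈r₁ y∈r₂))
      in a∉q (proj₂ (bags-crossing-edge t∈Side r₁∉Side a∈t a∈r₁))

  bag⊎separationᴸ : ∀ {S} (vs : List (Fin n)) → All (_∈ S) vs → (∃ λ t → All (_∈ β D t) vs) ⊎ Separation S
  bag⊎separationᴸ []       []            = inj₁ (fromℕ< (nonempty (T D)) , [])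
  bag⊎separationᴸ (c ∷ vs) (c∈S ∷ vs⊆S) with bag⊎separationᴸ vs vs⊆S
  ... | inj₂ sep = inj₂ sep
  ... | inj₁ (t , vs⊆t) with c ∈ₛ? β D t
  ...   | yes c∈t = inj₁ (t , c∈t ∷ vs⊆t)
  ...   | no c∉t
    with boundary-edge Tree-graph (λ r → c ∈ₛ? β D r) (connected (T D) t _ _ _) c∉t (proj₂ (vertexIn D c))
  ...     | entry@record { q = q ; Q-q = c∈q } with All.all? (_∈ₛ? β D q) vs
  ...       | yes vs⊆q = inj₁ (q , c∈q ∷ vs⊆q)
  ...       | no vs⊈q with All.lookupAny (All.zip (vs⊆S , vs⊆t)) (¬All⇒Any¬ (_∈ₛ? β D q) vs vs⊈q)
  ...         | (a∈S , a∈t) , a∉q = inj₂ record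
    { a = _ ; c = c ; a∈S = a∈S ; c∈S = c∈S ; t = t ; a∈t = a∈t ; entry = entry ; a∉q = a∉q }

  bag⊎separation : (S : Subset n) → (∃ λ t → S ⊆ β D t) ⊎ Separation S
  bag⊎separation S with bag⊎separationᴸ (filter (_∈ₛ? S) (allFin n)) (all-filter (_∈ₛ? S) (allFin n))
  ... | inj₂ sep = inj₂ sep
  ... | inj₁ (t , S⊆t) = inj₁ (t , λ v∈S → All.lookup S⊆t (∈-filter⁺ (_∈ₛ? S) (∈-allFin _) v∈S))

module _ {n : ℕ} (G : Graph n) {X Y S : Subset n} (shattered : Shattered G X Y S) where

  -- Realising U ∩ S rather than U makes the witness total.
  witness : Subset n → Fin n
  witness U = proj₁ (proj₂ shattered (U ∩ S) (p∩q⊆q U S))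

  witness-spec : ∀ U v → (v ∈ S × Adj G (witness U) v) ⇔ v ∈ U ∩ S
  witness-spec U = proj₂ (proj₂ (proj₂ shattered (U ∩ S) (p∩q⊆q U S)))

  witness-adjacent : ∀ {U v} → v ∈ U → v ∈ S → Adj G (witness U) v
  witness-adjacent {U} {v} v∈U v∈S = proj₂ (Equivalence.from (witness-spec U v) (x∈p∩q⁺ (v∈U , v∈S)))

  witness-injective : ∀ {U U′} → U ⊆ S → U′ ⊆ S → witness U ≡ witness U′ → U ≡ U′
  witness-injective U⊆S U′⊆S eq = ⊆-antisym (transfer U⊆S eq) (transfer U′⊆S (≡-sym eq))
    where
    transfer : ∀ {U U′} → U ⊆ S → witness U ≡ witness U′ → U ⊆ U′
    transfer {U} {U′} U⊆S eq {v} v∈U = p∩q⊆p U′ S (Equivalence.to (witness-spec U′ v)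
      (U⊆S v∈U , subst (λ y → Adj G y v) eq (witness-adjacent v∈U (U⊆S v∈U))))

  -- The witnesses of the sets between L and S are distinct common neighbours of L,
  -- and c ∈ L is not one of them.
  shattered-bound : ∀ {L B c w} → L ⊆ S → c ∈ L → c ∈ B → (∀ {y} → (∀ {v} → v ∈ L → Adj G y v) → y ∈ B)
                  → ∣ B ∣ ≤ suc w → 2 ^ ∣ S ∣ ≤ 2 ^ ∣ L ∣ * w
  shattered-bound {L} {B} {c} {w} L⊆S c∈L c∈B common⊆B ∣B∣≤1+w = begin
    2 ^ ∣ S ∣                 ≡⟨ ≡-sym (interval-length L⊆S) ⟩
    length Us * 2 ^ ∣ L ∣     ≡⟨ *-comm (length Us) _ ⟩
    2 ^ ∣ L ∣ * length Us     ≤⟨ *-monoʳ-≤ (2 ^ ∣ L ∣) length≤w ⟩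
    2 ^ ∣ L ∣ * w             ∎
    where
    open ≤-Reasoning
    Us = interval L S
    ys = map witness Us

    ys-common : All (λ y → ∀ {v} → v ∈ L → Adj G y v) ys
    ys-common = All-map⁺ (All.map (λ (L⊆U , _) {v} v∈L → witness-adjacent (L⊆U v∈L) (L⊆S v∈L))
                                  (interval-bounds L S))

    c∉ys : All (c ≢_) ys
    c∉ys = All.map (λ common c≡y → irrefl G (subst (λ y → Adj G y c) (≡-sym c≡y) (common c∈L))) ys-common

    ys-unique : Unique ys
    ys-unique = map⁺-injectiveOn witness (λ (_ , U⊆S) (_ , U′⊆S) → witness-injective U⊆S U′⊆S)
                  (interval-bounds L S) (interval-unique L S)

    length≤w : length Us ≤ w
    length≤w with ≤-trans (unique⊆⇒length≤∣p∣ (c∉ys ∷ ys-unique) (c∈B ∷ All.map common⊆B ys-common)) ∣B∣≤1+w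
    ... | s≤s length-ys≤w = subst (_≤ w) (length-map witness Us) length-ys≤w

lemma6 : {n : ℕ} (G : Graph n) (X Y : Subset n) (D : TreeDecomposition G) (tw : ℕ)
    → HasWidth D tw → (S : Subset n) → Shattered G X Y S
    → (2 ^ ∣ S ∣ ≤ 4 * tw) ⊎ (∃ λ t → S ⊆ β D t)
lemma6 G X Y D tw (bags≤1+tw , _) S shattered with bag⊎separation D S
... | inj₁ S⊆bag = inj₂ S⊆bag
... | inj₂ sep = inj₁ (begin
  2 ^ ∣ S ∣
    ≤⟨ shattered-bound G shattered (⁅x⁆∪⁅y⁆⊆p a∈S c∈S) c∈⁅a,c⁆ Q-q common⊆q (bags≤1+tw q) ⟩
  2 ^ ∣ ⁅ a ⁆ ∪ ⁅ c ⁆ ∣ * tw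
    ≤⟨ *-monoˡ-≤ tw (^-monoʳ-≤ 2 (∣⁅x⁆∪⁅y⁆∣≤2 a c)) ⟩
  4 * tw
    ∎)
  where
  open ≤-Reasoning
  open Separation sep
  c∈⁅a,c⁆ : c ∈ ⁅ a ⁆ ∪ ⁅ c ⁆
  c∈⁅a,c⁆ = x∈p∪q⁺ (inj₂ (x∈⁅x⁆ c))
  common⊆q : ∀ {y} → (∀ {v} → v ∈ ⁅ a ⁆ ∪ ⁅ c ⁆ → Adj G y v) → y ∈ β D q
  common⊆q adjacent = common-neighbour∈q D sep (adjacent (x∈p∪q⁺ (inj₁ (x∈⁅x⁆ a)))) (adjacent c∈⁅a,c⁆)
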